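{- Let $r,k$ be positive integers with $k<r/2$, let $n,m\geq 1$, and let $\varphi$ be an $(r,k)$-colouring of $K_{n,m}$. If there are a vertex $v$ and a set $\mathcal{C}\subseteq[r]$ of $k$ colours such that no edge $e$ incident with $v$ has $\varphi(e)=\mathcal{C}$, then $\mathrm{tc}(K_{n,m},\varphi)\leq 2r-3k+1$.
   Context: For integers $r\geq k\geq 1$, an $(r,k)$-colouring of a graph $G$ is a function $\varphi:E(G)\to\binom{[r]}{k}$, assigning to each edge a set of exactly $k$ colours from $[r]=\{1,\dots,r\}$. A subgraph $H\subseteq G$ is monochromatic if there is a colour $i$ belonging to $\varphi(e)$ for every $e\in E(H)$. $\mathrm{tc}(G,\varphi)$ is the minimum number of monochromatic trees (a single vertex counts as a tree) whose union covers $V(G)$. $K_{n,m}$ is the complete bipartite graph with parts of sizes $n$ and $m$. -}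

module Defs where

open import Data.Nat using (ℕ; _≤_)
open import Data.Fin using (Fin)
open import Data.Fin.Subset using (Subset; ∣_∣) renaming (_∈_ to _∈ₛ_)
open import Data.Sum using (_⊎_; inj₁; inj₂)
open import Data.Product using (Σ; _×_; _,_)
open import Data.Empty using (⊥)
open import Data.List using (List; []; _∷_; [_]; length)
open import Data.List.Membership.Propositional using (_∈_; _∉_)
open import Relation.Binary.PropositionalEquality using (_≡_)

-- Vertices of K_{n,m}: left part Fin n, right part Fin m.
-- Edges of K_{n,m}: exactly the pairs (i , j) with i : Fin n, j : Fin m.
Vertex : ℕ → ℕ → Set
Vertex n m = Fin n ⊎ Fin m

EdgeColouring : ℕ → ℕ → ℕ → Set
EdgeColouring r n m = Fin n → Fin m → Subset r

IsRKColouring : ∀ {r n m} → ℕ → EdgeColouring r n m → Set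
IsRKColouring {n = n} {m} k φ = ∀ (i : Fin n) (j : Fin m) → ∣ φ i j ∣ ≡ k

Incident : ∀ {n m} → Vertex n m → Fin n → Fin m → Set
Incident v i j = (v ≡ inj₁ i) ⊎ (v ≡ inj₂ j)

AdjIn : ∀ {r n m} → EdgeColouring r n m → Fin r → Vertex n m → Vertex n m → Set
AdjIn φ c (inj₁ i) (inj₁ _) = ⊥
AdjIn φ c (inj₁ i) (inj₂ j) = c ∈ₛ φ i j
AdjIn φ c (inj₂ j) (inj₁ i) = c ∈ₛ φ i j
AdjIn φ c (inj₂ _) (inj₂ _) = ⊥

-- MonoTree φ c vs : vs is the vertex list of a tree in K_{n,m} all of whose
-- edges contain colour c.
data MonoTree {r n m} (φ : EdgeColouring r n m) (c : Fin r) : List (Vertex n m) → Set where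
  single : (v : Vertex n m) → MonoTree φ c [ v ]
  leaf   : ∀ {vs} → MonoTree φ c vs → (u w : Vertex n m) →
           w ∈ vs → u ∉ vs → AdjIn φ c u w → MonoTree φ c (u ∷ vs)

record MTree {r n m} (φ : EdgeColouring r n m) : Set where
  constructor mtree
  field
    colour   : Fin r
    vertices : List (Vertex n m)
    isTree   : MonoTree φ colour vertices

open MTree public

Covers : ∀ {r n m} {φ : EdgeColouring r n m} → List (MTree φ) → Vertex n m → Set
Covers ts v = Σ _ λ T → (T ∈ ts) × (v ∈ vertices T)

TcAtMost : ∀ {r n m} → EdgeColouring r n m → ℕ → Set
TcAtMost {n = n} {m} φ t =
  Σ (List (MTree φ)) λ ts → (length ts ≤ t) × (∀ (v : Vertex n m) → Covers ts v)

module Submission where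

-- By symmetry the given vertex is some x on the left.  First find y₀ and a k-set K,
-- disjoint from A = φ(xy₀), that is not the colour set of any edge at x; it comes out
-- of an iteration starting from C in which ∣φ(xy) ∩ C∣ strictly grows.  Then take, for
-- each colour c ∈ A, the c-coloured double star on the edge xy₀; for each colour
-- outside A ∪ K, the c-stars at x and at y₀; and one star at y₀ in a colour of K.
-- A right vertex y is reached from x in a colour of φ(xy) ∖ K, which exists as
-- φ(xy) ≠ K; a left vertex x′ is reached from y₀ in a colour of φ(x′y₀) ∖ K, or by
-- the last star when φ(x′y₀) = K.  These are k + 2(r − 2k) + 1 = 2r − 3k + 1 trees.

open import Defs
open import Data.Nat using (ℕ; zero; suc; _+_; _*_; _∸_; _≤_; _<_; z≤n; s≤s)
open import Data.Nat.Properties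
open import Data.Nat.Tactic.RingSolver using (solve-∀)
open import Data.Fin using (Fin; zero; suc)
open import Data.Fin.Properties using (any?) renaming (_≟_ to _≟ᶠ_)
open import Data.Fin.Subset
  using (Subset; ∣_∣; inside; outside; _∪_; _∩_; ∁; ⁅_⁆; ⊥; Nonempty)
  renaming (_∈_ to _∈ₛ_; _∉_ to _∉ₛ_; _⊆_ to _⊆ₛ_; _⊂_ to _⊂ₛ_)
open import Data.Fin.Subset.Properties
open import Data.Vec using ([]; _∷_; here; there)
open import Data.Vec.Properties using (≡-dec)
open import Data.Bool using () renaming (_≟_ to _≟ᵇ_)
open import Data.Product using (Σ; ∃; _×_; _,_; proj₁; proj₂)
open import Data.Sum using (_⊎_; inj₁; inj₂; [_,_]; swap)
open import Data.Sum.Properties using (swap-involutive) renaming (≡-dec to ≡-dec-⊎)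
open import Data.List using (List; []; _∷_; _++_; length; map; allFin)
open import Data.List.Properties using (length-++; length-map)
open import Data.List.Membership.Propositional using (_∈_; _∉_)
open import Data.List.Membership.Propositional.Properties
  using (∈-map⁺; ∈-map⁻; ∈-allFin; ∈-++⁺ˡ; ∈-++⁺ʳ)
import Data.List.Membership.DecPropositional as DecMembership
open import Data.List.Relation.Unary.Any using (here; there)
open import Data.List.Relation.Binary.Subset.Propositional using () renaming (_⊆_ to _⊆ᴸ_)
open import Function using (_∘_; id)
open import Data.Empty using (⊥-elim)
open import Relation.Nullary using (¬_; Dec; yes; no)
open import Relation.Nullary.Negation using (contradiction)
open import Relation.Nullary.Decidable using (_×-dec_; ¬?; decidable-stable)
open import Relation.Binary.PropositionalEquality
  using (_≡_; _≢_; refl; sym; trans; cong; cong₂; subst; ≢-sym; module ≡-Reasoning)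

private
  variable
    r : ℕ
    p q : Subset r

_≟ₛ_ : (p q : Subset r) → Dec (p ≡ q)
_≟ₛ_ = ≡-dec _≟ᵇ_

p⊈q⇒∃x∈p∧x∉q : ¬ p ⊆ₛ q → ∃ λ x → x ∈ₛ p × x ∉ₛ q
p⊈q⇒∃x∈p∧x∉q {p = p} {q} p⊈q with any? (λ x → x ∈? p ×-dec ¬? (x ∈? q))
... | yes witness = witness
... | no none = ⊥-elim (p⊈q λ {x} x∈p → decidable-stable (x ∈? q) (λ x∉q → none (x , x∈p , x∉q)))

p⊆q∧∣q∣≤∣p∣⇒p≡q : p ⊆ₛ q → ∣ q ∣ ≤ ∣ p ∣ → p ≡ q
p⊆q∧∣q∣≤∣p∣⇒p≡q {p = p} {q} p⊆q ∣q∣≤∣p∣ with q ⊆? p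
... | yes q⊆p = ⊆-antisym p⊆q q⊆p
... | no q⊈p with p⊈q⇒∃x∈p∧x∉q q⊈p
...   | x , x∈q , x∉p = contradiction (p⊂q⇒∣p∣<∣q∣ (p⊆q , x , x∈q , x∉p)) (≤⇒≯ ∣q∣≤∣p∣)

∣q∣≤∣p∣∧p≢q⇒∃x∈p∧x∉q : ∣ q ∣ ≤ ∣ p ∣ → p ≢ q → ∃ λ x → x ∈ₛ p × x ∉ₛ q
∣q∣≤∣p∣∧p≢q⇒∃x∈p∧x∉q ∣q∣≤∣p∣ p≢q =
  p⊈q⇒∃x∈p∧x∉q (λ p⊆q → p≢q (p⊆q∧∣q∣≤∣p∣⇒p≡q p⊆q ∣q∣≤∣p∣))

1≤∣p∣⇒Nonempty : ∀ (p : Subset r) → 1 ≤ ∣ p ∣ → Nonempty p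
1≤∣p∣⇒Nonempty (inside ∷ p) _ = zero , here
1≤∣p∣⇒Nonempty (outside ∷ p) 1≤∣p∣ with 1≤∣p∣⇒Nonempty p 1≤∣p∣
... | x , x∈p = suc x , there x∈p

∣p∪q∣≡∣p∣+∣q∣ : ∀ (p q : Subset r) → (∀ {x} → x ∈ₛ p → x ∉ₛ q) → ∣ p ∪ q ∣ ≡ ∣ p ∣ + ∣ q ∣
∣p∪q∣≡∣p∣+∣q∣ [] [] _ = refl
∣p∪q∣≡∣p∣+∣q∣ (inside ∷ p) (inside ∷ q) disjoint = contradiction here (disjoint here)
∣p∪q∣≡∣p∣+∣q∣ (inside ∷ p) (outside ∷ q) disjoint =
  cong suc (∣p∪q∣≡∣p∣+∣q∣ p q (λ x∈p → disjoint (there x∈p) ∘ there))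
∣p∪q∣≡∣p∣+∣q∣ (outside ∷ p) (inside ∷ q) disjoint =
  trans (cong suc (∣p∪q∣≡∣p∣+∣q∣ p q (λ x∈p → disjoint (there x∈p) ∘ there))) (sym (+-suc ∣ p ∣ ∣ q ∣))
∣p∪q∣≡∣p∣+∣q∣ (outside ∷ p) (outside ∷ q) disjoint =
  ∣p∪q∣≡∣p∣+∣q∣ p q (λ x∈p → disjoint (there x∈p) ∘ there)

∃-⊆-⊆-∣∣≡ : ∀ (q p : Subset r) {k} → q ⊆ₛ p → ∣ q ∣ ≤ k → k ≤ ∣ p ∣ →
            ∃ λ s → q ⊆ₛ s × s ⊆ₛ p × ∣ s ∣ ≡ k
∃-⊆-⊆-∣∣≡ [] [] {zero} _ _ _ = [] , id , id , refl
∃-⊆-⊆-∣∣≡ (inside ∷ q) (outside ∷ p) q⊆p _ _ = contradiction (q⊆p here) λ ()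
∃-⊆-⊆-∣∣≡ (inside ∷ q) (inside ∷ p) {suc k} q⊆p (s≤s ∣q∣≤k) (s≤s k≤∣p∣)
  with ∃-⊆-⊆-∣∣≡ q p (drop-∷-⊆ q⊆p) ∣q∣≤k k≤∣p∣
... | s , q⊆s , s⊆p , ∣s∣≡k = inside ∷ s , in⊆in q⊆s , in⊆in s⊆p , cong suc ∣s∣≡k
∃-⊆-⊆-∣∣≡ (outside ∷ q) (outside ∷ p) q⊆p ∣q∣≤k k≤∣p∣
  with ∃-⊆-⊆-∣∣≡ q p (drop-∷-⊆ q⊆p) ∣q∣≤k k≤∣p∣
... | s , q⊆s , s⊆p , ∣s∣≡k = outside ∷ s , s⊆s q⊆s , s⊆s s⊆p , ∣s∣≡k
∃-⊆-⊆-∣∣≡ (outside ∷ q) (inside ∷ p) {k} q⊆p ∣q∣≤k k≤1+∣p∣ with k ≤? ∣ p ∣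
... | yes k≤∣p∣ with ∃-⊆-⊆-∣∣≡ q p (drop-∷-⊆ q⊆p) ∣q∣≤k k≤∣p∣
...   | s , q⊆s , s⊆p , ∣s∣≡k = outside ∷ s , s⊆s q⊆s , out⊆ s⊆p , ∣s∣≡k
∃-⊆-⊆-∣∣≡ (outside ∷ q) (inside ∷ p) q⊆p _ k≤1+∣p∣ | no k≰∣p∣ =
  inside ∷ p , out⊆ (drop-∷-⊆ q⊆p) , id , ≤-antisym (≰⇒> k≰∣p∣) k≤1+∣p∣

forEach : ∀ {X : Set} (p : Subset r) → ((x : Fin r) → x ∈ₛ p → X) → List X
forEach [] f = []
forEach (inside ∷ p) f = f zero here ∷ forEach p (λ x → f (suc x) ∘ there)
forEach (outside ∷ p) f = forEach p (λ x → f (suc x) ∘ there)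

length-forEach : ∀ {X : Set} (p : Subset r) (f : (x : Fin r) → x ∈ₛ p → X) →
                 length (forEach p f) ≡ ∣ p ∣
length-forEach [] f = refl
length-forEach (inside ∷ p) f = cong suc (length-forEach p _)
length-forEach (outside ∷ p) f = length-forEach p _

∈-forEach : ∀ {X : Set} {p : Subset r} (f : (x : Fin r) → x ∈ₛ p → X) {x} (x∈p : x ∈ₛ p) →
            f x x∈p ∈ forEach p f
∈-forEach {p = inside ∷ p} f here = here refl
∈-forEach {p = inside ∷ p} f (there x∈p) = there (∈-forEach _ x∈p)
∈-forEach {p = outside ∷ p} f (there x∈p) = ∈-forEach _ x∈p

boundedAscent : ∀ {A R : Set} (g : A → ℕ) (b : ℕ) → (∀ a → g a < b) →
                (∀ a → R ⊎ ∃ λ a′ → g a < g a′) → A → R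
boundedAscent {A} {R} g b g<b step a = climb b a (m≤m+n b (g a))
  where
  climb : (fuel : ℕ) (a : A) → b ≤ fuel + g a → R
  climb zero a b≤ga = contradiction (g<b a) (≤⇒≯ b≤ga)
  climb (suc fuel) a b≤ with step a
  ... | inj₁ result = result
  ... | inj₂ (a′ , ga<ga′) = climb fuel a′ (≤-trans b≤ (+-monoʳ-< fuel ga<ga′))

record DisjointMissingSet {m : ℕ} (k : ℕ) (F : Fin m → Subset r) : Set where
  constructor disjointMissing
  field
    y₀      : Fin m
    K       : Subset r
    ∣K∣≡k   : ∣ K ∣ ≡ k
    K∩Fy₀≡∅ : ∀ {c} → c ∈ₛ K → c ∉ₛ F y₀
    F≢K     : ∀ y → F y ≢ K

module _ {m k : ℕ} (F : Fin m → Subset r) (C : Subset r) (2k<r : 2 * k < r)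
         (∣C∣≡k : ∣ C ∣ ≡ k) (∣F∣≡k : ∀ y → ∣ F y ∣ ≡ k) (F≢C : ∀ y → F y ≢ C) where

  private
    occurs? : (S : Subset r) → Dec (∃ λ y → F y ≡ S)
    occurs? S = any? (λ y → F y ≟ₛ S)

    C⊈F : ∀ y → ∃ λ c → c ∈ₛ C × c ∉ₛ F y
    C⊈F y = ∣q∣≤∣p∣∧p≢q⇒∃x∈p∧x∉q (≤-reflexive (trans (∣F∣≡k y) (sym ∣C∣≡k))) (≢-sym (F≢C y))

    ∣F∩C∣<k : ∀ y → ∣ F y ∩ C ∣ < k
    ∣F∩C∣<k y with C⊈F y
    ... | c , c∈C , c∉Fy = subst (∣ F y ∩ C ∣ <_) ∣C∣≡k
      (p⊂q⇒∣p∣<∣q∣ (p∩q⊆q (F y) C , c , c∈C , c∉Fy ∘ p∩q⊆p (F y) C))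

    -- With c₀ ∈ C ∖ A, pick a k-set B avoiding A ∪ {c₀} (room since r > 2k).  If B = F y′,
    -- pick a k-set A′ with (A ∪ {c₀}) ∩ C ⊆ A′ ⊆ A ∪ {c₀}; it is disjoint from F y′, and
    -- if also A′ = F y″ then F y″ shares more colours with C than A does.
    module Step (y : Fin m) (c₀ : Fin r) (c₀∈C : c₀ ∈ₛ C) (c₀∉A : c₀ ∉ₛ F y) where
      A P Q : Subset r
      A = F y
      P = A ∪ ⁅ c₀ ⁆
      Q = P ∩ C

      ∣P∣≡k+1 : ∣ P ∣ ≡ k + 1
      ∣P∣≡k+1 = trans (∣p∪q∣≡∣p∣+∣q∣ A ⁅ c₀ ⁆ c∈A⇒c∉⁅c₀⁆) (cong₂ _+_ (∣F∣≡k y) (∣⁅x⁆∣≡1 c₀))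
        where
        c∈A⇒c∉⁅c₀⁆ : ∀ {c} → c ∈ₛ A → c ∉ₛ ⁅ c₀ ⁆
        c∈A⇒c∉⁅c₀⁆ c∈A c∈⁅c₀⁆ = c₀∉A (subst (_∈ₛ A) (x∈⁅y⁆⇒x≡y _ c∈⁅c₀⁆) c∈A)

      k≤∣∁P∣ : k ≤ ∣ ∁ P ∣
      k≤∣∁P∣ = begin
        k             ≤⟨ m+n≤o⇒m≤o∸n k (subst (_≤ r) (1+2k≡k+[k+1] k) 2k<r) ⟩
        r ∸ (k + 1)   ≡⟨ cong (r ∸_) ∣P∣≡k+1 ⟨
        r ∸ ∣ P ∣     ≡⟨ ∣∁p∣≡n∸∣p∣ P ⟨
        ∣ ∁ P ∣       ∎
        where
        open ≤-Reasoning
        1+2k≡k+[k+1] : ∀ k → suc (2 * k) ≡ k + (k + 1)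
        1+2k≡k+[k+1] = solve-∀

      A∩C⊂A′∩C : ∀ {A′} → Q ⊆ₛ A′ → A ∩ C ⊂ₛ A′ ∩ C
      A∩C⊂A′∩C Q⊆A′ = (λ c∈A∩C → x∈p∩q⁺ (Q⊆A′ (A∩C⊆Q c∈A∩C) , p∩q⊆q A C c∈A∩C))
                    , c₀ , x∈p∩q⁺ (Q⊆A′ c₀∈Q , c₀∈C) , c₀∉A ∘ p∩q⊆p A C
        where
        A∩C⊆Q : A ∩ C ⊆ₛ Q
        A∩C⊆Q c∈A∩C = x∈p∩q⁺ (p⊆p∪q ⁅ c₀ ⁆ (p∩q⊆p A C c∈A∩C) , p∩q⊆q A C c∈A∩C)
        c₀∈Q : c₀ ∈ₛ Q
        c₀∈Q = x∈p∩q⁺ (q⊆p∪q A ⁅ c₀ ⁆ (x∈⁅x⁆ c₀) , c₀∈C)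

      progressFrom : DisjointMissingSet k F ⊎ ∃ λ y′ → ∣ A ∩ C ∣ < ∣ F y′ ∩ C ∣
      progressFrom with ∃-⊆-⊆-∣∣≡ ⊥ (∁ P) ⊥⊆ (≤-trans (≤-reflexive (∣⊥∣≡0 r)) z≤n) k≤∣∁P∣
      ... | B , _ , B⊆∁P , ∣B∣≡k with occurs? B
      ...   | no B-missing = inj₁ (disjointMissing y B ∣B∣≡k
                (λ c∈B c∈A → x∈∁p⇒x∉p (B⊆∁P c∈B) (p⊆p∪q ⁅ c₀ ⁆ c∈A)) λ y′ → B-missing ∘ (y′ ,_))
      ...   | yes (y′ , Fy′≡B)
              with ∃-⊆-⊆-∣∣≡ Q P (p∩q⊆p P C) (≤-trans (∣p∩q∣≤∣q∣ P C) (≤-reflexive ∣C∣≡k))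
                     (≤-trans (≤-reflexive (sym (∣F∣≡k y))) (∣p∣≤∣p∪q∣ A ⁅ c₀ ⁆))
      ...     | A′ , Q⊆A′ , A′⊆P , ∣A′∣≡k with occurs? A′
      ...       | no A′-missing = inj₁ (disjointMissing y′ A′ ∣A′∣≡k
                    (λ c∈A′ c∈Fy′ → x∈∁p⇒x∉p (B⊆∁P (subst (_ ∈ₛ_) Fy′≡B c∈Fy′)) (A′⊆P c∈A′))
                    λ y″ → A′-missing ∘ (y″ ,_))
      ...       | yes (y″ , Fy″≡A′) = inj₂ (y″ , subst (λ S → ∣ A ∩ C ∣ < ∣ S ∩ C ∣) (sym Fy″≡A′)
                    (p⊂q⇒∣p∣<∣q∣ (A∩C⊂A′∩C Q⊆A′)))

  disjointMissingSet : Fin m → DisjointMissingSet k F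
  disjointMissingSet = boundedAscent (λ y → ∣ F y ∩ C ∣) k ∣F∩C∣<k progress
    where
    progress : ∀ y → DisjointMissingSet k F ⊎ ∃ λ y′ → ∣ F y ∩ C ∣ < ∣ F y′ ∩ C ∣
    progress y with C⊈F y
    ... | c₀ , c₀∈C , c₀∉Fy = Step.progressFrom y c₀ c₀∈C c₀∉Fy

module _ {n m : ℕ} (φ : EdgeColouring r n m) where

  ContainsNeighbours : Fin r → Vertex n m → List (Vertex n m) → Set
  ContainsNeighbours c w vs = ∀ u → AdjIn φ c u w → u ∈ vs

  private
    adj? : ∀ c (u w : Vertex n m) → Dec (AdjIn φ c u w)
    adj? c (inj₁ i) (inj₁ j) = no λ ()
    adj? c (inj₁ i) (inj₂ j) = c ∈? φ i j
    adj? c (inj₂ j) (inj₁ i) = c ∈? φ i j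
    adj? c (inj₂ i) (inj₂ j) = no λ ()

    open DecMembership (≡-dec-⊎ (_≟ᶠ_ {n}) (_≟ᶠ_ {m})) using () renaming (_∈?_ to _∈ᴸ?_)

    allVertices : List (Vertex n m)
    allVertices = map inj₁ (allFin n) ++ map inj₂ (allFin m)

    ∈-allVertices : ∀ v → v ∈ allVertices
    ∈-allVertices (inj₁ i) = ∈-++⁺ˡ (∈-map⁺ inj₁ (∈-allFin i))
    ∈-allVertices (inj₂ j) = ∈-++⁺ʳ _ (∈-map⁺ inj₂ (∈-allFin j))

  attachNeighbours : ∀ {c vs w} → MonoTree φ c vs → w ∈ vs → (us : List (Vertex n m)) →
                     ∃ λ vs′ → MonoTree φ c vs′ × vs ⊆ᴸ vs′ ×
                               (∀ {u} → u ∈ us → AdjIn φ c u w → u ∈ vs′)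
  attachNeighbours t w∈vs [] = _ , t , id , λ ()
  attachNeighbours {c} {w = w} t w∈vs (u ∷ us) with attachNeighbours t w∈vs us
  ... | vs′ , t′ , vs⊆vs′ , N with u ∈ᴸ? vs′ | adj? c u w
  ...   | yes u∈vs′ | _ = vs′ , t′ , vs⊆vs′ , λ { (here refl) _ → u∈vs′ ; (there u′∈us) → N u′∈us }
  ...   | no u∉vs′ | yes u~w = u ∷ vs′ , leaf t′ u w (vs⊆vs′ w∈vs) u∉vs′ u~w , there ∘ vs⊆vs′ ,
          λ { (here refl) _ → here refl ; (there u′∈us) → there ∘ N u′∈us }
  ...   | no _ | no u≁w = vs′ , t′ , vs⊆vs′ ,
          λ { (here refl) u~w → contradiction u~w u≁w ; (there u′∈us) → N u′∈us }

  extendAt : ∀ {c vs w} → MonoTree φ c vs → w ∈ vs →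
             ∃ λ vs′ → MonoTree φ c vs′ × vs ⊆ᴸ vs′ × ContainsNeighbours c w vs′
  extendAt t w∈vs with attachNeighbours t w∈vs allVertices
  ... | vs′ , t′ , vs⊆vs′ , N = vs′ , t′ , vs⊆vs′ , λ u → N (∈-allVertices u)

  star : (c : Fin r) (w : Vertex n m) → Σ (MTree φ) λ T → ContainsNeighbours c w (vertices T)
  star c w with extendAt (single w) (here refl)
  ... | vs , t , _ , N = mtree c vs t , N

  doubleStar : ∀ {c w₁ w₂} → AdjIn φ c w₂ w₁ →
               Σ (MTree φ) λ T → ContainsNeighbours c w₁ (vertices T) × ContainsNeighbours c w₂ (vertices T)
  doubleStar {c} {w₁} {w₂} w₂~w₁ with extendAt (single w₁) (here refl)
  ... | vs₁ , t₁ , _ , N₁ with extendAt t₁ (N₁ w₂ w₂~w₁)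
  ...   | vs₂ , t₂ , vs₁⊆vs₂ , N₂ = mtree c vs₂ t₂ , (λ u → vs₁⊆vs₂ ∘ N₁ u) , N₂

s+[k+k]≡r⇒k+[s+s]≡2r∸3k : ∀ {r k s} → s + (k + k) ≡ r → k + (s + s) ≡ 2 * r ∸ 3 * k
s+[k+k]≡r⇒k+[s+s]≡2r∸3k {k = k} {s} refl = begin
  k + (s + s)                  ≡⟨ m+n∸n≡m (k + (s + s)) (3 * k) ⟨
  k + (s + s) + 3 * k ∸ 3 * k  ≡⟨ cong (_∸ 3 * k) (regroup k s) ⟩
  2 * (s + (k + k)) ∸ 3 * k    ∎
  where
  open ≡-Reasoning
  regroup : ∀ k s → k + (s + s) + 3 * k ≡ 2 * (s + (k + k))
  regroup = solve-∀

module _ {k n m : ℕ} (φ : EdgeColouring r n m) (φ-k : IsRKColouring k φ) (1≤k : 1 ≤ k)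
         (x : Fin n) (M : DisjointMissingSet k (φ x)) where

  open DisjointMissingSet M

  private
    A R : Subset r
    A = φ x y₀
    R = ∁ (A ∪ K)

    double : ∀ c → c ∈ₛ A → Σ (MTree φ) λ T →
             ContainsNeighbours φ c (inj₁ x) (vertices T) × ContainsNeighbours φ c (inj₂ y₀) (vertices T)
    double c = doubleStar φ

    K-nonempty : Nonempty K
    K-nonempty = 1≤∣p∣⇒Nonempty K (subst (1 ≤_) (sym ∣K∣≡k) 1≤k)

    starInK : Σ (MTree φ) λ T → ContainsNeighbours φ (proj₁ K-nonempty) (inj₂ y₀) (vertices T)
    starInK = star φ (proj₁ K-nonempty) (inj₂ y₀)

    doubles starsAtX starsAtY : List (MTree φ)
    doubles  = forEach A (λ c → proj₁ ∘ double c)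
    starsAtX = forEach R (λ c _ → proj₁ (star φ c (inj₁ x)))
    starsAtY = forEach R (λ c _ → proj₁ (star φ c (inj₂ y₀)))

    trees : List (MTree φ)
    trees = proj₁ starInK ∷ doubles ++ starsAtX ++ starsAtY

    c∉A∪K : ∀ {c} → c ∉ₛ A → c ∉ₛ K → c ∈ₛ R
    c∉A∪K c∉A c∉K = x∉p⇒x∈∁p λ c∈A∪K → [ c∉A , c∉K ] (x∈p∪q⁻ A K c∈A∪K)

    coveredVia : ∀ u c → c ∉ₛ K → AdjIn φ c u (inj₁ x) ⊎ AdjIn φ c u (inj₂ y₀) → Covers trees u
    coveredVia u c c∉K u~ with c ∈? A | u~
    ... | yes c∈A | inj₁ u~x =
      _ , there (∈-++⁺ˡ (∈-forEach _ c∈A)) , proj₁ (proj₂ (double c c∈A)) u u~x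
    ... | yes c∈A | inj₂ u~y₀ =
      _ , there (∈-++⁺ˡ (∈-forEach _ c∈A)) , proj₂ (proj₂ (double c c∈A)) u u~y₀
    ... | no c∉A | inj₁ u~x =
      _ , there (∈-++⁺ʳ doubles (∈-++⁺ˡ (∈-forEach _ (c∉A∪K c∉A c∉K)))) ,
      proj₂ (star φ c (inj₁ x)) u u~x
    ... | no c∉A | inj₂ u~y₀ =
      _ , there (∈-++⁺ʳ doubles (∈-++⁺ʳ starsAtX (∈-forEach _ (c∉A∪K c∉A c∉K)))) ,
      proj₂ (star φ c (inj₂ y₀)) u u~y₀

    colourOutsideK : ∀ i j → φ i j ≢ K → ∃ λ c → c ∈ₛ φ i j × c ∉ₛ K
    colourOutsideK i j = ∣q∣≤∣p∣∧p≢q⇒∃x∈p∧x∉q (≤-reflexive (trans ∣K∣≡k (sym (φ-k i j))))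

    covers : ∀ v → Covers trees v
    covers (inj₂ y) with colourOutsideK x y (F≢K y)
    ... | c , c∈φxy , c∉K = coveredVia (inj₂ y) c c∉K (inj₁ c∈φxy)
    covers (inj₁ x′) with φ x′ y₀ ≟ₛ K
    ... | yes φx′y₀≡K =
      _ , here refl , proj₂ starInK (inj₁ x′) (subst (_ ∈ₛ_) (sym φx′y₀≡K) (proj₂ K-nonempty))
    ... | no φx′y₀≢K with colourOutsideK x′ y₀ φx′y₀≢K
    ...   | c , c∈φx′y₀ , c∉K = coveredVia (inj₁ x′) c c∉K (inj₂ c∈φx′y₀)

    ∣R∣+[k+k]≡r : ∣ R ∣ + (k + k) ≡ r
    ∣R∣+[k+k]≡r = begin
      ∣ R ∣ + (k + k)           ≡⟨ cong (∣ R ∣ +_) (cong₂ _+_ (φ-k x y₀) ∣K∣≡k) ⟨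
      ∣ R ∣ + (∣ A ∣ + ∣ K ∣)   ≡⟨ cong (∣ R ∣ +_) (∣p∪q∣≡∣p∣+∣q∣ A K λ c∈A c∈K → K∩Fy₀≡∅ c∈K c∈A) ⟨
      ∣ R ∣ + ∣ A ∪ K ∣         ≡⟨ cong (_+ ∣ A ∪ K ∣) (∣∁p∣≡n∸∣p∣ (A ∪ K)) ⟩
      r ∸ ∣ A ∪ K ∣ + ∣ A ∪ K ∣ ≡⟨ m∸n+n≡m (∣p∣≤n (A ∪ K)) ⟩
      r                         ∎
      where open ≡-Reasoning

    length-trees : length trees ≡ 2 * r ∸ 3 * k + 1
    length-trees = begin
      suc (length (doubles ++ starsAtX ++ starsAtY))
        ≡⟨ cong suc (length-++ doubles) ⟩
      suc (length doubles + length (starsAtX ++ starsAtY))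
        ≡⟨ cong (λ l → suc (length doubles + l)) (length-++ starsAtX) ⟩
      suc (length doubles + (length starsAtX + length starsAtY))
        ≡⟨ cong suc (cong₂ _+_ (trans (length-forEach A _) (φ-k x y₀))
                               (cong₂ _+_ (length-forEach R _) (length-forEach R _))) ⟩
      suc (k + (∣ R ∣ + ∣ R ∣))
        ≡⟨ cong suc (s+[k+k]≡r⇒k+[s+s]≡2r∸3k {k = k} {∣ R ∣} ∣R∣+[k+k]≡r) ⟩
      suc (2 * r ∸ 3 * k)
        ≡⟨ +-comm 1 _ ⟩
      2 * r ∸ 3 * k + 1
        ∎
      where open ≡-Reasoning

  disjointMissingSet⇒tcAtMost : TcAtMost φ (2 * r ∸ 3 * k + 1)
  disjointMissingSet⇒tcAtMost = trees , ≤-reflexive length-trees , covers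

swap-∉ : ∀ {A B : Set} {u : A ⊎ B} {vs : List (A ⊎ B)} → u ∉ vs → swap u ∉ map swap vs
swap-∉ {u = u} {vs} u∉vs su∈ with ∈-map⁻ swap su∈
... | v , v∈vs , su≡sv = u∉vs (subst (_∈ vs) v≡u v∈vs)
  where
  v≡u : v ≡ u
  v≡u = trans (sym (swap-involutive v)) (trans (cong swap (sym su≡sv)) (swap-involutive u))

transpose : ∀ {n m} → EdgeColouring r n m → EdgeColouring r m n
transpose φ j i = φ i j

module _ {n m : ℕ} {φ : EdgeColouring r n m} {c : Fin r} where

  AdjIn-transpose : ∀ u w → AdjIn φ c u w → AdjIn (transpose φ) c (swap u) (swap w)
  AdjIn-transpose (inj₁ i) (inj₂ j) u~w = u~w
  AdjIn-transpose (inj₂ j) (inj₁ i) u~w = u~w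

  MonoTree-transpose : ∀ {vs} → MonoTree φ c vs → MonoTree (transpose φ) c (map swap vs)
  MonoTree-transpose (single v) = single (swap v)
  MonoTree-transpose (leaf t u w w∈vs u∉vs u~w) =
    leaf (MonoTree-transpose t) (swap u) (swap w) (∈-map⁺ swap w∈vs) (swap-∉ u∉vs) (AdjIn-transpose u w u~w)

MTree-transpose : ∀ {n m} {φ : EdgeColouring r n m} → MTree φ → MTree (transpose φ)
MTree-transpose (mtree c vs t) = mtree c (map swap vs) (MonoTree-transpose t)

TcAtMost-transpose : ∀ {n m t} (φ : EdgeColouring r n m) → TcAtMost (transpose φ) t → TcAtMost φ t
TcAtMost-transpose {t = t} φ (ts , ∣ts∣≤t , covers) =
  map MTree-transpose ts , subst (_≤ t) (sym (length-map _ ts)) ∣ts∣≤t , covers′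
  where
  covers′ : ∀ v → Covers (map MTree-transpose ts) v
  covers′ v with covers (swap v)
  ... | T , T∈ts , sv∈T = MTree-transpose T , ∈-map⁺ MTree-transpose T∈ts ,
                          subst (_∈ map swap (vertices T)) (swap-involutive v) (∈-map⁺ swap sv∈T)

lemma3p4 : (r k n m : ℕ) → 1 ≤ k → 2 * k < r → 1 ≤ n → 1 ≤ m →
    (φ : EdgeColouring r n m) → IsRKColouring k φ →
    (v : Vertex n m) → (C : Subset r) → ∣ C ∣ ≡ k →
    (∀ (i : Fin n) (j : Fin m) → Incident v i j → φ i j ≢ C) →
    TcAtMost φ (2 * r ∸ 3 * k + 1)
lemma3p4 r k n m 1≤k 2k<r _ (s≤s _) φ φ-k (inj₁ x) C ∣C∣≡k C-missing =
  disjointMissingSet⇒tcAtMost φ φ-k 1≤k x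
    (disjointMissingSet (φ x) C 2k<r ∣C∣≡k (φ-k x) (λ y → C-missing x y (inj₁ refl)) zero)
lemma3p4 r k n m 1≤k 2k<r (s≤s _) _ φ φ-k (inj₂ y) C ∣C∣≡k C-missing =
  TcAtMost-transpose φ (disjointMissingSet⇒tcAtMost (transpose φ) (λ j i → φ-k i j) 1≤k y
    (disjointMissingSet (λ x → φ x y) C 2k<r ∣C∣≡k (λ x → φ-k x y)
      (λ x → C-missing x y (inj₂ refl)) zero))
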